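{- Let $\tilde{\alpha},\tilde{\beta}$ be two sequences of face-down cards of the same length lying in the work space, and let $\gamma\,\delta$ be a face-down 2-card representation of a bit $b$ lying in the work space. There is a secure oblivious card-based protocol during which the players swap the sequences $\tilde{\alpha}$ and $\tilde{\beta}$ if and only if $b=1$. The protocol uses two auxiliary cards $\clubsuit$.
   Context: Cards have suit $\heartsuit$ or $\clubsuit$ and identical backs. In the 2-card encoding, bit $1$ is represented by the face-down pair $\heartsuit\clubsuit$ and bit $0$ by $\clubsuit\heartsuit$. Two players (Alice and Bob) operate on cards placed on numbered table positions; the work space is a set of positions not holding committed input cards. Allowed actions: moving a card between positions, shuffling cards on a set of work space positions by a random permutation from a prescribed set (e.g. a uniformly random cyclic shift), and turning a card over. The visible state is which positions are occupied together with the visible face of each card. A protocol is oblivious if its next action depends only on the current visible state and the number of actions taken so far. Security here means that the distribution of the sequence of visible states during the protocol is the same regardless of the value of $b$ (and of the hidden cards), so no information about $b$ is revealed. -}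

module Defs where

open import Data.Bool using (Bool; true; false; if_then_else_)
open import Data.Nat using (ℕ; zero; suc; _+_)
open import Data.Fin using (Fin; _↑ˡ_; _↑ʳ_) renaming (zero to fz; suc to fs)
open import Data.Fin.Properties using () renaming (_≟_ to _≟ᶠ_)
open import Data.Integer using (+_)
open import Data.Rational using (ℚ; 0ℚ; 1ℚ; _/_) renaming (_+_ to _+ℚ_; _*_ to _*ℚ_)
open import Data.List using (List; []; _∷_; length; foldr)
open import Data.Vec using (Vec; tabulate; lookup)
open import Data.Maybe using (Maybe; just; nothing)
open import Data.Product using (_×_; _,_; proj₁; proj₂; Σ)
open import Data.Unit using (⊤)
open import Data.Empty using (⊥)
open import Relation.Nullary using (¬_; yes; no; does)
open import Relation.Binary.Definitions using (DecidableEquality)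
open import Relation.Binary.PropositionalEquality using (_≡_; _≢_; refl)
open import Function.Definitions using (Injective)
import Data.Vec.Properties as VecP
import Data.List.Properties as ListP
import Data.Maybe.Properties as MaybeP
open import Data.List.Relation.Unary.Unique.Propositional using (Unique)

data Suit : Set where
  ♥ ♣ : Suit

_≟ˢ_ : DecidableEquality Suit
♥ ≟ˢ ♥ = yes refl
♥ ≟ˢ ♣ = no (λ ())
♣ ≟ˢ ♥ = no (λ ())
♣ ≟ˢ ♣ = yes refl

-- A card: its suit and whether it is face up (true) or face down (false).
Card : Set
Card = Suit × Bool

-- What one sees at a position: nothing (empty position),
-- just nothing (a card back), just (just s) (a face-up card of suit s).
Vis : Set
Vis = Maybe (Maybe Suit)

_≟ᵛ_ : DecidableEquality Vis
_≟ᵛ_ = MaybeP.≡-dec (MaybeP.≡-dec _≟ˢ_)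

visCard : Maybe Card → Vis
visCard nothing              = nothing
visCard (just (s , true))    = just (just s)
visCard (just (s , false))   = just nothing

State : ℕ → Set
State M = Fin M → Maybe Card

-- Visible state (as a vector, so that equality is decidable).
VisState : ℕ → Set
VisState M = Vec Vis M

view : ∀ {M} → State M → VisState M
view s = tabulate (λ i → visCard (s i))

Trace : ℕ → Set
Trace M = List (VisState M)

_≟ᵗ_ : ∀ {M} → DecidableEquality (Trace M)
_≟ᵗ_ = ListP.≡-dec (VecP.≡-dec _≟ᵛ_)

-- A permutation of positions is given by its table σ; applying it,
-- the card at position (lookup σ j) ends up at position j.
data Action (M : ℕ) : Set where
  move    : Fin M → Fin M → Action M
  turn    : Fin M → Action M
  shuffle : List (Vec (Fin M) M) → Action M     -- apply a uniformly random element of the set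

Occupied : ∀ {M} → VisState M → Fin M → Set
Occupied v i = lookup v i ≢ nothing

IsPerm : ∀ {M} → Vec (Fin M) M → Set
IsPerm σ = Injective _≡_ _≡_ (lookup σ)

ValidAction : ∀ {M} → VisState M → Action M → Set
ValidAction v (move i j)   = Occupied v i × (lookup v j ≡ nothing)
ValidAction v (turn i)     = Occupied v i
ValidAction v (shuffle Π)  =
  (Π ≢ []) × Unique Π ×
  (∀ {σ} → Data.List.Membership.Propositional._∈_ σ Π →
     IsPerm σ × (∀ j → lookup σ j ≢ j → Occupied v j))
  where import Data.List.Membership.Propositional

flip : Bool → Bool
flip true  = false
flip false = true

applyMove : ∀ {M} → Fin M → Fin M → State M → State M
applyMove i j s p with does (p ≟ᶠ j) | does (p ≟ᶠ i)
... | true  | _     = s i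
... | false | true  = nothing
... | false | false = s p

applyTurn : ∀ {M} → Fin M → State M → State M
applyTurn i s p with does (p ≟ᶠ i) | s p
... | true | just (c , u) = just (c , flip u)
... | _    | x            = x

applyPerm : ∀ {M} → Vec (Fin M) M → State M → State M
applyPerm σ s j = s (lookup σ j)

-- Finite probability trees: a node chooses a child uniformly at random.

data Tree (A : Set) : Set where
  leaf : A → Tree A
  node : List (Tree A) → Tree A

mutual
  bindT : ∀ {A B : Set} → Tree A → (A → Tree B) → Tree B
  bindT (leaf a)  f = f a
  bindT (node ts) f = node (bindL ts f)

  bindL : ∀ {A B : Set} → List (Tree A) → (A → Tree B) → List (Tree B)
  bindL []       f = []
  bindL (t ∷ ts) f = bindT t f ∷ bindL ts f

mapT : ∀ {A B : Set} → (A → B) → Tree A → Tree B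
mapT f t = bindT t (λ a → leaf (f a))

mutual
  prob : ∀ {A : Set} → (A → Bool) → Tree A → ℚ
  prob P (leaf a)        = if P a then 1ℚ else 0ℚ
  prob P (node [])       = 0ℚ
  prob P (node (t ∷ ts)) = (+ 1 / length (t ∷ ts)) *ℚ sumProb P (t ∷ ts)

  sumProb : ∀ {A : Set} → (A → Bool) → List (Tree A) → ℚ
  sumProb P []       = 0ℚ
  sumProb P (t ∷ ts) = prob P t +ℚ sumProb P ts

mutual
  AllT : ∀ {A : Set} → (A → Set) → Tree A → Set
  AllT P (leaf a)  = P a
  AllT P (node ts) = AllL P ts

  AllL : ∀ {A : Set} → (A → Set) → List (Tree A) → Set
  AllL P []       = ⊤
  AllL P (t ∷ ts) = AllT P t × AllL P ts

-- Oblivious protocols: the next action depends only on the number of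
-- actions taken so far and on the current visible state.

record Protocol (M : ℕ) : Set where
  field
    steps : ℕ
    act   : ℕ → VisState M → Action M
    valid : ∀ k v → ValidAction v (act k v)

stepA : ∀ {M} → Action M → State M → Tree (State M)
stepA (move i j)  s = leaf (applyMove i j s)
stepA (turn i)    s = leaf (applyTurn i s)
stepA (shuffle Π) s = node (Data.List.map (λ σ → leaf (applyPerm σ s)) Π)

-- Outcome of a run: the sequence of visible states after each action,
-- together with the final (hidden) state.
exec : ∀ {M} → Protocol M → (remaining k : ℕ) → State M → Tree (Trace M × State M)
exec P zero      k s = leaf ([] , s)
exec P (suc r)   k s =
  bindT (stepA (Protocol.act P k (view s)) s) λ s′ →
    mapT (λ o → (view s′ ∷ proj₁ o , proj₂ o)) (exec P r (suc k) s′)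

run : ∀ {M} → Protocol M → State M → Tree (Trace M × State M)
run P s = mapT (λ o → (view s ∷ proj₁ o , proj₂ o)) (exec P (Protocol.steps P) 0 s)

-- The input: two sequences α̃, β̃ of n face-down cards and the two cards
-- γ δ of a 2-card bit encoding, placed (injectively) on a table of N
-- positions; the protocol may use `e` further empty work-space
-- positions and two auxiliary ♣ cards on positions N and N+1.

data Slot (n : ℕ) : Set where
  αs βs : Fin n → Slot n
  γs δs : Slot n

Layout : ℕ → ℕ → Set
Layout n N = Σ (Slot n → Fin N) (Injective _≡_ _≡_)

content : ∀ {n} → Vec Suit n → Vec Suit n → Bool → Slot n → Suit
content α β b (αs i) = lookup α i
content α β b (βs i) = lookup β i
content α β b γs     = if b then ♥ else ♣
content α β b δs     = if b then ♣ else ♥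

Table : ℕ → ℕ → ℕ
Table N e = N + (2 + e)

pos : ∀ {n N} → Layout n N → (e : ℕ) → Slot n → Fin (Table N e)
pos L e x = proj₁ L x ↑ˡ (2 + e)

aux₁ aux₂ : ∀ N e → Fin (Table N e)
aux₁ N e = N ↑ʳ fz
aux₂ N e = N ↑ʳ fs fz

Initial : ∀ {n N} → Layout n N → (e : ℕ) →
          Vec Suit n → Vec Suit n → Bool → State (Table N e) → Set
Initial {n} {N} L e α β b s =
  (∀ x → s (pos L e x) ≡ just (content α β b x , false)) ×
  (s (aux₁ N e) ≡ just (♣ , false)) ×
  (s (aux₂ N e) ≡ just (♣ , false)) ×
  (∀ p → (∀ x → p ≢ pos L e x) → p ≢ aux₁ N e → p ≢ aux₂ N e → s p ≡ nothing)

SwappedIff : ∀ {n N} → Layout n N → (e : ℕ) →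
             Vec Suit n → Vec Suit n → Bool → State (Table N e) → Set
SwappedIff L e α β b s =
  ∀ i → (s (pos L e (αs i)) ≡ just ((if b then lookup β i else lookup α i) , false)) ×
        (s (pos L e (βs i)) ≡ just ((if b then lookup α i else lookup β i) , false))

Correct : ∀ {n N} → Layout n N → (e : ℕ) → Protocol (Table N e) → Set
Correct L e P = ∀ α β b s → Initial L e α β b s →
  AllT (λ o → SwappedIff L e α β b (proj₂ o)) (run P s)

Secure : ∀ {n N} → Layout n N → (e : ℕ) → Protocol (Table N e) → Set
Secure L e P = ∀ α β b s α′ β′ b′ s′ →
  Initial L e α β b s → Initial L e α′ β′ b′ s′ →
  ∀ (t : Trace _) →
    prob (λ o → does (proj₁ o ≟ᵗ t)) (run P s) ≡
    prob (λ o → does (proj₁ o ≟ᵗ t)) (run P s′)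

-- Shuffle the inputs by a random bisection: with probability 1/2 nothing happens, otherwise
-- every αᵢ is exchanged with βᵢ and γ with δ; call this hidden coin t.  Turning γ over now
-- shows ♥ exactly when b ⊕ t = 1, and exchanging once more in that case leaves the sequences
-- exchanged t + (b ⊕ t) ≡ b (mod 2) times.  Since t is uniform, the revealed suit b ⊕ t is a
-- uniform bit whatever the input is, and every other visible state is determined by it and by
-- the initial view, which is the same for all inputs.  The two auxiliary ♣ are never touched.
module Submission where

open import Defs
open import Algebra.Definitions using (Involutive)
open import Data.Bool using (Bool; true; false; if_then_else_)
open import Data.Empty using (⊥-elim)
open import Data.Fin using (Fin)
open import Data.Fin.Properties using (any?; all?; ↑ˡ-injective) renaming (_≟_ to _≟ᶠ_)
open import Data.List using ([]; _∷_)
open import Data.List.Relation.Unary.Any using (here; there)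
import Data.List.Relation.Unary.All as All
import Data.List.Relation.Unary.AllPairs as AllPairs
open import Data.Maybe using (just; nothing)
import Data.Maybe as Maybe
open import Data.Nat using (ℕ; suc)
open import Data.Product using (Σ; ∃; _×_; _,_; proj₁; proj₂; map₂)
open import Data.Unit using (tt)
open import Data.Vec using (Vec; tabulate; lookup; allFin; _[_]≔_)
open import Data.Vec.Properties
  using (lookup∘tabulate; tabulate∘lookup; tabulate-cong; lookup-allFin; lookup∘update; lookup∘update′)
open import Function using (_∘_; id; case_of_)
open import Relation.Nullary using (¬_; Dec; yes; no; does)
open import Relation.Nullary.Decidable using (_→-dec_; ¬?)
open import Relation.Binary.PropositionalEquality

coin : {A : Set} → A → A → Tree A
coin x y = node (node (leaf x ∷ []) ∷ node (leaf y ∷ []) ∷ [])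

prob-coin-comm : {A : Set} (P : A → Bool) (x y : A) → prob P (coin x y) ≡ prob P (coin y x)
prob-coin-comm P x y with P x | P y
... | true  | true  = refl
... | true  | false = refl
... | false | true  = refl
... | false | false = refl

module _ {M : ℕ} where

  applyTurn-here : (i : Fin M) (a : State M) → applyTurn i a i ≡ Maybe.map (map₂ flip) (a i)
  applyTurn-here i a with i ≟ᶠ i | a i
  ... | yes _  | just _  = refl
  ... | yes _  | nothing = refl
  ... | no i≢i | _       = ⊥-elim (i≢i refl)

  applyTurn-other : {i p : Fin M} (a : State M) → p ≢ i → applyTurn i a p ≡ a p
  applyTurn-other {i} {p} a p≢i with p ≟ᶠ i | a p
  ... | yes p≡i | _       = ⊥-elim (p≢i p≡i)
  ... | no _    | just _  = refl
  ... | no _    | nothing = refl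

  applyTurn-just : {c : Card} (i : Fin M) (a : State M) {p : Fin M} → a p ≡ just c →
                   ∃ λ c′ → applyTurn i a p ≡ just c′
  applyTurn-just i a {p} ap≡c = case p ≟ᶠ i of λ where
    (yes refl) → _ , trans (applyTurn-here i a) (cong (Maybe.map (map₂ flip)) ap≡c)
    (no p≢i)   → _ , trans (applyTurn-other a p≢i) ap≡c

  applyPerm-applyTurn : (σ : Vec (Fin M) M) → Involutive _≡_ (lookup σ) → (i : Fin M) (a : State M) →
                        ∀ p → applyPerm σ (applyTurn i a) p ≡ applyTurn (lookup σ i) (applyPerm σ a) p
  applyPerm-applyTurn σ σ-inv i a p = commute (p ≟ᶠ lookup σ i)
    where
    open ≡-Reasoning
    commute : Dec (p ≡ lookup σ i) → applyTurn i a (lookup σ p) ≡ applyTurn (lookup σ i) (applyPerm σ a) p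
    commute (yes refl) = begin
      applyTurn i a (lookup σ (lookup σ i))               ≡⟨ cong (applyTurn i a) (σ-inv i) ⟩
      applyTurn i a i                                     ≡⟨ applyTurn-here i a ⟩
      Maybe.map (map₂ flip) (a i)                         ≡⟨ cong (Maybe.map (map₂ flip) ∘ a) (σ-inv i) ⟨
      Maybe.map (map₂ flip) (applyPerm σ a (lookup σ i))  ≡⟨ applyTurn-here (lookup σ i) (applyPerm σ a) ⟨
      applyTurn (lookup σ i) (applyPerm σ a) (lookup σ i) ∎
    commute (no p≢σi) = trans (applyTurn-other a σp≢i) (sym (applyTurn-other (applyPerm σ a) p≢σi))
      where
      σp≢i : lookup σ p ≢ i
      σp≢i σp≡i = p≢σi (trans (sym (σ-inv p)) (cong (lookup σ) σp≡i))

  lookup-view : (a : State M) (p : Fin M) → lookup (view a) p ≡ visCard (a p)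
  lookup-view a = lookup∘tabulate (visCard ∘ a)

  view-cong : {a a′ : State M} → (∀ p → a p ≡ a′ p) → view a ≡ view a′
  view-cong a≗a′ = tabulate-cong (cong visCard ∘ a≗a′)

  view-≗-lookup : (a : State M) (v : VisState M) → (∀ p → visCard (a p) ≡ lookup v p) → view a ≡ v
  view-≗-lookup a v eq = trans (tabulate-cong eq) (tabulate∘lookup v)

  view-applyTurn : {i : Fin M} {a : State M} {c : Suit} → a i ≡ just (c , false) →
                   view (applyTurn i a) ≡ view a [ i ]≔ just (just c)
  view-applyTurn {i} {a} {c} ai≡c = view-≗-lookup (applyTurn i a) _ visible
    where
    open ≡-Reasoning
    visible : ∀ p → visCard (applyTurn i a p) ≡ lookup (view a [ i ]≔ just (just c)) p
    visible p = case p ≟ᶠ i of λ where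
      (yes refl) → begin
        visCard (applyTurn i a i)                ≡⟨ cong visCard (applyTurn-here i a) ⟩
        visCard (Maybe.map (map₂ flip) (a i))    ≡⟨ cong (visCard ∘ Maybe.map (map₂ flip)) ai≡c ⟩
        just (just c)                            ≡⟨ lookup∘update i (view a) _ ⟨
        lookup (view a [ i ]≔ just (just c)) i   ∎
      (no p≢i) → begin
        visCard (applyTurn i a p)                ≡⟨ cong visCard (applyTurn-other a p≢i) ⟩
        visCard (a p)                            ≡⟨ lookup-view a p ⟨
        lookup (view a) p                        ≡⟨ lookup∘update′ p≢i (view a) _ ⟨
        lookup (view a [ i ]≔ just (just c)) p   ∎

  occupied-view : {a : State M} {p : Fin M} {c : Card} → a p ≡ just c → Occupied (view a) p
  occupied-view {a} {p} {_ , u} ap≡c empty =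
    visCard-just u (trans (cong visCard (sym ap≡c)) (trans (sym (lookup-view a p)) empty))
    where
    visCard-just : ∀ {s} u → visCard (just (s , u)) ≢ nothing
    visCard-just true  ()
    visCard-just false ()

  MovesOccupied : VisState M → Vec (Fin M) M → Set
  MovesOccupied v σ = ∀ j → lookup σ j ≢ j → Occupied v j

  movesOccupied? : (v : VisState M) (σ : Vec (Fin M) M) → Dec (MovesOccupied v σ)
  movesOccupied? v σ = all? λ j → ¬? (lookup σ j ≟ᶠ j) →-dec ¬? (lookup v j ≟ᵛ nothing)

  involutive⇒isPerm : {σ : Vec (Fin M) M} → Involutive _≡_ (lookup σ) → IsPerm σ
  involutive⇒isPerm {σ} σ-inv {i} {j} σi≡σj = trans (sym (σ-inv i)) (trans (cong (lookup σ) σi≡σj) (σ-inv j))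

  identity-involutive : Involutive _≡_ (lookup (allFin M))
  identity-involutive j = trans (lookup-allFin _) (lookup-allFin j)

  identity-movesOccupied : (v : VisState M) → MovesOccupied v (allFin M)
  identity-movesOccupied v j moved = ⊥-elim (moved (lookup-allFin j))

  shuffle₁-valid : {v : VisState M} {σ : Vec (Fin M) M} →
                   IsPerm σ → MovesOccupied v σ → ValidAction v (shuffle (σ ∷ []))
  shuffle₁-valid perm occ = (λ ()) , All.[] AllPairs.∷ AllPairs.[] , λ where
    (here refl) → perm , occ

  shuffle₂-valid : {v : VisState M} {σ σ′ : Vec (Fin M) M} → σ ≢ σ′ →
                   IsPerm σ → MovesOccupied v σ → IsPerm σ′ → MovesOccupied v σ′ →
                   ValidAction v (shuffle (σ ∷ σ′ ∷ []))
  shuffle₂-valid σ≢σ′ perm occ perm′ occ′ =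
    (λ ()) , (σ≢σ′ All.∷ All.[]) AllPairs.∷ (All.[] AllPairs.∷ AllPairs.[]) , λ where
      (here refl)         → perm , occ
      (there (here refl)) → perm′ , occ′

  skip : Action M
  skip = shuffle (allFin M ∷ [])

  skip-valid : (v : VisState M) → ValidAction v skip
  skip-valid v = shuffle₁-valid {v = v} {σ = allFin M}
    (involutive⇒isPerm {σ = allFin M} identity-involutive) (identity-movesOccupied v)

  -- An oblivious protocol must prescribe a legal action in every visible state, reachable or
  -- not; `when` falls back to the trivial shuffle wherever its guard fails.
  when : {A : Set} → Dec A → Action M → Action M
  when (yes _) a = a
  when (no _)  _ = skip

  when-valid : {A : Set} {v : VisState M} (d : Dec A) {a : Action M} →
               (A → ValidAction v a) → ValidAction v (when d a)
  when-valid (yes x) valid = valid x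
  when-valid {v = v} (no _) _ = skip-valid v

  when-yes : {A : Set} (d : Dec A) {a : Action M} → A → when d a ≡ a
  when-yes (yes _) _ = refl
  when-yes (no ¬x) x = ⊥-elim (¬x x)

logView : {M : ℕ} → State M → Trace M × State M → Trace M × State M
logView s o = view s ∷ proj₁ o , proj₂ o

exec-step : {M : ℕ} (P : Protocol M) {r k : ℕ} {s : State M} {a : Action M} →
            Protocol.act P k (view s) ≡ a →
            exec P (suc r) k s ≡ bindT (stepA a s) (λ s′ → mapT (logView s′) (exec P r (suc k) s′))
exec-step P {r} {k} {s} act≡a = cong (λ a → bindT (stepA a s) (λ s′ → mapT (logView s′) (exec P r (suc k) s′))) act≡a

module BitControlledSwap {n N : ℕ} (L : Layout n N) where

  M : ℕ
  M = Table N 0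

  slot : Slot n → Fin M
  slot = pos L 0

  slot-injective : {x y : Slot n} → slot x ≡ slot y → x ≡ y
  slot-injective eq = proj₂ L (↑ˡ-injective 2 _ _ eq)

  slot? : (p : Fin M) → Dec (∃ λ x → slot x ≡ p)
  slot? p with any? (λ i → slot (αs i) ≟ᶠ p) | any? (λ i → slot (βs i) ≟ᶠ p)
             | slot γs ≟ᶠ p | slot δs ≟ᶠ p
  ... | yes (i , eq) | _ | _ | _ = yes (αs i , eq)
  ... | no _ | yes (i , eq) | _ | _ = yes (βs i , eq)
  ... | no _ | no _ | yes eq | _ = yes (γs , eq)
  ... | no _ | no _ | no _ | yes eq = yes (δs , eq)
  ... | no ¬α | no ¬β | no ¬γ | no ¬δ = no λ where
    (αs i , eq) → ¬α (i , eq)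
    (βs i , eq) → ¬β (i , eq)
    (γs , eq)   → ¬γ eq
    (δs , eq)   → ¬δ eq

  γ : Fin M
  γ = slot γs

  mirror : Slot n → Slot n
  mirror (αs i) = βs i
  mirror (βs i) = αs i
  mirror γs     = δs
  mirror δs     = γs

  mirror-involutive : Involutive _≡_ mirror
  mirror-involutive (αs i) = refl
  mirror-involutive (βs i) = refl
  mirror-involutive γs     = refl
  mirror-involutive δs     = refl

  swapIf : Bool → Slot n → Slot n
  swapIf true  = mirror
  swapIf false = id

  mirrorPos : Fin M → Fin M
  mirrorPos p with slot? p
  ... | yes (x , _) = slot (mirror x)
  ... | no _        = p

  mirrorPos-slot : (x : Slot n) → mirrorPos (slot x) ≡ slot (mirror x)
  mirrorPos-slot x with slot? (slot x)
  ... | yes (y , y≡x) = cong (slot ∘ mirror) (slot-injective y≡x)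
  ... | no unslotted  = ⊥-elim (unslotted (x , refl))

  mirrorPos-unslotted : {p : Fin M} → ¬ (∃ λ x → slot x ≡ p) → mirrorPos p ≡ p
  mirrorPos-unslotted {p} unslotted with slot? p
  ... | yes slotted = ⊥-elim (unslotted slotted)
  ... | no _        = refl

  mirrorPos-involutive : Involutive _≡_ mirrorPos
  mirrorPos-involutive p with slot? p
  ... | yes (x , refl) = trans (mirrorPos-slot (mirror x)) (cong slot (mirror-involutive x))
  ... | no unslotted   = mirrorPos-unslotted unslotted

  swapPerm : Bool → Vec (Fin M) M
  swapPerm false = allFin M
  swapPerm true  = tabulate mirrorPos

  lookup-swapPerm-slot : (t : Bool) (x : Slot n) → lookup (swapPerm t) (slot x) ≡ slot (swapIf t x)
  lookup-swapPerm-slot false x = lookup-allFin (slot x)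
  lookup-swapPerm-slot true  x = trans (lookup∘tabulate mirrorPos (slot x)) (mirrorPos-slot x)

  lookup-swapPerm-unslotted : (t : Bool) {p : Fin M} → ¬ (∃ λ x → slot x ≡ p) → lookup (swapPerm t) p ≡ p
  lookup-swapPerm-unslotted false {p} _ = lookup-allFin p
  lookup-swapPerm-unslotted true  {p} unslotted = trans (lookup∘tabulate mirrorPos p) (mirrorPos-unslotted unslotted)

  swapPerm-involutive : (t : Bool) → Involutive _≡_ (lookup (swapPerm t))
  swapPerm-involutive false = identity-involutive
  swapPerm-involutive true p = begin
    lookup (tabulate mirrorPos) (lookup (tabulate mirrorPos) p) ≡⟨ lookup∘tabulate mirrorPos _ ⟩
    mirrorPos (lookup (tabulate mirrorPos) p)                   ≡⟨ cong mirrorPos (lookup∘tabulate mirrorPos p) ⟩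
    mirrorPos (mirrorPos p)                                     ≡⟨ mirrorPos-involutive p ⟩
    p                                                           ∎
    where open ≡-Reasoning

  swapPerm-isPerm : (t : Bool) → IsPerm (swapPerm t)
  swapPerm-isPerm t = involutive⇒isPerm {σ = swapPerm t} (swapPerm-involutive t)

  swapPerm-distinct : swapPerm false ≢ swapPerm true
  swapPerm-distinct eq with slot-injective (begin
    slot γs                      ≡⟨ lookup-swapPerm-slot false γs ⟨
    lookup (swapPerm false) γ    ≡⟨ cong (λ σ → lookup σ γ) eq ⟩
    lookup (swapPerm true) γ     ≡⟨ lookup-swapPerm-slot true γs ⟩
    slot δs                      ∎)
    where open ≡-Reasoning
  ... | ()

  SlotsOccupied : State M → Set
  SlotsOccupied a = ∀ x → ∃ λ c → a (slot x) ≡ just c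

  FaceDown : State M → Set
  FaceDown a = ∀ x → ∃ λ c → a (slot x) ≡ just (c , false)

  faceDown⇒slotsOccupied : {a : State M} → FaceDown a → SlotsOccupied a
  faceDown⇒slotsOccupied down x = _ , proj₂ (down x)

  faceDown-swapPerm : {a : State M} → FaceDown a → (t : Bool) → FaceDown (applyPerm (swapPerm t) a)
  faceDown-swapPerm {a} down t x =
    proj₁ (down (swapIf t x)) , trans (cong a (lookup-swapPerm-slot t x)) (proj₂ (down (swapIf t x)))

  swapPerm-movesOccupied : {a : State M} → SlotsOccupied a → (t : Bool) → MovesOccupied (view a) (swapPerm t)
  swapPerm-movesOccupied {a} occupied t j moved = case slot? j of λ where
    (yes (x , refl)) → occupied-view {a = a} (proj₂ (occupied x))
    (no unslotted)   → ⊥-elim (moved (lookup-swapPerm-unslotted t unslotted))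

  view-swapPerm : {a : State M} → FaceDown a → (t : Bool) → view (applyPerm (swapPerm t) a) ≡ view a
  view-swapPerm {a} down t = tabulate-cong looksAlike
    where
    open ≡-Reasoning
    looksAlike : ∀ p → visCard (a (lookup (swapPerm t) p)) ≡ visCard (a p)
    looksAlike p = case slot? p of λ where
      (yes (x , refl)) → begin
        visCard (a (lookup (swapPerm t) (slot x))) ≡⟨ cong (visCard ∘ a) (lookup-swapPerm-slot t x) ⟩
        visCard (a (slot (swapIf t x)))            ≡⟨ cong visCard (proj₂ (down (swapIf t x))) ⟩
        just nothing                               ≡⟨ cong visCard (proj₂ (down x)) ⟨
        visCard (a (slot x))                       ∎
      (no unslotted) → cong (visCard ∘ a) (lookup-swapPerm-unslotted t unslotted)

  isHeart : Suit → Bool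
  isHeart ♥ = true
  isHeart ♣ = false

  showsHeart : Vis → Bool
  showsHeart (just (just c)) = isHeart c
  showsHeart _               = false

  act : ℕ → VisState M → Action M
  act 0 v = when (movesOccupied? v (swapPerm true)) (shuffle (swapPerm false ∷ swapPerm true ∷ []))
  act 1 v = when (¬? (lookup v γ ≟ᵛ nothing)) (turn γ)
  act 2 v = when (movesOccupied? v (swapPerm heart)) (shuffle (swapPerm heart ∷ []))
    where heart = showsHeart (lookup v γ)
  act (suc (suc (suc _))) _ = skip

  act-valid : (k : ℕ) (v : VisState M) → ValidAction v (act k v)
  act-valid 0 v = when-valid (movesOccupied? v (swapPerm true)) λ occ →
    shuffle₂-valid {v = v} swapPerm-distinct (swapPerm-isPerm false) (identity-movesOccupied v) (swapPerm-isPerm true) occ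
  act-valid 1 v = when-valid (¬? (lookup v γ ≟ᵛ nothing)) λ occ → occ
  act-valid 2 v = when-valid (movesOccupied? v (swapPerm heart)) (shuffle₁-valid {v = v} (swapPerm-isPerm heart))
    where heart = showsHeart (lookup v γ)
  act-valid (suc (suc (suc _))) v = skip-valid v

  protocol : Protocol M
  protocol = record { steps = 3 ; act = act ; valid = act-valid }

  -- After a ♥ has been revealed at γ the second swap carries it to δ's position.
  revealTrace : VisState M → Suit → Trace M
  revealTrace v c = v ∷ v [ γ ]≔ just (just c) ∷ v [ lookup (swapPerm (isHeart c)) γ ]≔ just (just c) ∷ []

  reveal : Suit → State M → State M
  reveal c a = applyPerm (swapPerm (isHeart c)) (applyTurn γ a)

  act₂-≡ : {c : Suit} (v : VisState M) → lookup v γ ≡ just (just c) →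
           MovesOccupied v (swapPerm (isHeart c)) → act 2 v ≡ shuffle (swapPerm (isHeart c) ∷ [])
  act₂-≡ {c} v vγ≡c occ rewrite vγ≡c = when-yes (movesOccupied? v (swapPerm (isHeart c))) occ

  exec-reveal : {a : State M} {c : Suit} → FaceDown a → a γ ≡ just (c , false) →
                mapT (logView a) (exec protocol 2 1 a) ≡ node (leaf (revealTrace (view a) c , reveal c a) ∷ [])
  exec-reveal {a} {c} down aγ≡c = begin
    mapT (logView a) (exec protocol 2 1 a)
      ≡⟨ cong (mapT (logView a)) (exec-step protocol {r = 1} {k = 1} act₁-≡) ⟩
    mapT (logView a) (mapT (logView turned) (exec protocol 1 2 turned))
      ≡⟨ cong (mapT (logView a) ∘ mapT (logView turned)) (exec-step protocol {r = 0} {k = 2} act₂-turned) ⟩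
    node (leaf (view a ∷ view turned ∷ view (reveal c a) ∷ [] , reveal c a) ∷ [])
      ≡⟨ cong₂ (λ u w → node (leaf (view a ∷ u ∷ w ∷ [] , reveal c a) ∷ [])) (view-applyTurn aγ≡c) view-reveal ⟩
    node (leaf (revealTrace (view a) c , reveal c a) ∷ [])
      ∎
    where
    open ≡-Reasoning
    turned = applyTurn γ a
    heart = isHeart c
    act₁-≡ : act 1 (view a) ≡ turn γ
    act₁-≡ = when-yes (¬? (lookup (view a) γ ≟ᵛ nothing)) (occupied-view {a = a} aγ≡c)
    act₂-turned : act 2 (view turned) ≡ shuffle (swapPerm heart ∷ [])
    act₂-turned = act₂-≡ (view turned)
      (trans (lookup-view turned γ) (cong visCard (trans (applyTurn-here γ a) (cong (Maybe.map (map₂ flip)) aγ≡c))))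
      (swapPerm-movesOccupied {a = turned} (λ x → applyTurn-just γ a (proj₂ (down x))) heart)
    view-reveal : view (reveal c a) ≡ view a [ lookup (swapPerm heart) γ ]≔ just (just c)
    view-reveal = begin
      view (applyPerm (swapPerm heart) turned)
        ≡⟨ view-cong (applyPerm-applyTurn (swapPerm heart) (swapPerm-involutive heart) γ a) ⟩
      view (applyTurn (lookup (swapPerm heart) γ) (applyPerm (swapPerm heart) a))
        ≡⟨ view-applyTurn (trans (cong a (swapPerm-involutive heart γ)) aγ≡c) ⟩
      view (applyPerm (swapPerm heart) a) [ lookup (swapPerm heart) γ ]≔ just (just c)
        ≡⟨ cong (_[ lookup (swapPerm heart) γ ]≔ just (just c)) (view-swapPerm down heart) ⟩
      view a [ lookup (swapPerm heart) γ ]≔ just (just c)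
        ∎

  traceOf : VisState M → Suit → Trace M
  traceOf v c = v ∷ revealTrace v c

  traceCoin : VisState M → Tree (Trace M)
  traceCoin v = coin (traceOf v ♣) (traceOf v ♥)

  -- The suit revealed at γ is ♥ exactly when b ⊕ t = 1, so the two swaps compose to b.
  net-swap : (α β : Vec Suit n) (b t : Bool) (x : Slot n) →
             swapIf t (swapIf (isHeart (content α β b (swapIf t γs))) x) ≡ swapIf b x
  net-swap α β true  true  x = refl
  net-swap α β true  false x = refl
  net-swap α β false true  x = mirror-involutive x
  net-swap α β false false x = refl

  swapIf-sequences : (α β : Vec Suit n) (b : Bool) (i : Fin n) →
    content α β b (swapIf b (αs i)) ≡ (if b then lookup β i else lookup α i) ×
    content α β b (swapIf b (βs i)) ≡ (if b then lookup α i else lookup β i)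
  swapIf-sequences α β true  i = refl , refl
  swapIf-sequences α β false i = refl , refl

  module Run {α β : Vec Suit n} {b : Bool} {s : State M} (init : Initial L 0 α β b s) where

    faceDown : FaceDown s
    faceDown x = content α β b x , proj₁ init x

    shuffled : Bool → State M
    shuffled t = applyPerm (swapPerm t) s

    suitAtγ : Bool → Suit
    suitAtγ t = content α β b (swapIf t γs)

    outcome : Bool → State M
    outcome t = reveal (suitAtγ t) (shuffled t)

    run-≡ : run protocol s ≡ coin (traceOf (view s) (suitAtγ false) , outcome false)
                                  (traceOf (view s) (suitAtγ true)  , outcome true)
    run-≡ = cong (mapT (logView s))
      (trans (exec-step protocol {r = 2} {k = 0} act₀-≡) (cong₂ (λ l r → node (l ∷ r ∷ [])) (branch false) (branch true)))
      where
      act₀-≡ : act 0 (view s) ≡ shuffle (swapPerm false ∷ swapPerm true ∷ [])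
      act₀-≡ = when-yes (movesOccupied? (view s) (swapPerm true))
                        (swapPerm-movesOccupied {a = s} (faceDown⇒slotsOccupied {a = s} faceDown) true)
      branch : ∀ t → mapT (logView (shuffled t)) (exec protocol 2 1 (shuffled t)) ≡
                     node (leaf (revealTrace (view s) (suitAtγ t) , outcome t) ∷ [])
      branch t = trans
        (exec-reveal (faceDown-swapPerm {a = s} faceDown t) (trans (cong s (lookup-swapPerm-slot t γs)) (proj₁ init (swapIf t γs))))
        (cong (λ v → node (leaf (revealTrace v (suitAtγ t) , outcome t) ∷ [])) (view-swapPerm {a = s} faceDown t))

    outcome-slot : (t : Bool) (x : Slot n) → (∀ u → swapIf u x ≢ γs) →
                   outcome t (slot x) ≡ just (content α β b (swapIf b x) , false)
    outcome-slot t x notγ = begin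
      applyTurn γ (shuffled t) (lookup (swapPerm heart) (slot x)) ≡⟨ cong (applyTurn γ (shuffled t)) (lookup-swapPerm-slot heart x) ⟩
      applyTurn γ (shuffled t) (slot (swapIf heart x))            ≡⟨ applyTurn-other (shuffled t) (notγ heart ∘ slot-injective) ⟩
      s (lookup (swapPerm t) (slot (swapIf heart x)))             ≡⟨ cong s (lookup-swapPerm-slot t (swapIf heart x)) ⟩
      s (slot (swapIf t (swapIf heart x)))                        ≡⟨ cong (s ∘ slot) (net-swap α β b t x) ⟩
      s (slot (swapIf b x))                                       ≡⟨ proj₁ init (swapIf b x) ⟩
      just (content α β b (swapIf b x) , false)                   ∎
      where
      open ≡-Reasoning
      heart = isHeart (suitAtγ t)

    outcome-swapped : (t : Bool) → SwappedIff L 0 α β b (outcome t)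
    outcome-swapped t i =
      trans (outcome-slot t (αs i) λ { true () ; false () }) (cong (λ c → just (c , false)) (proj₁ (swapIf-sequences α β b i))) ,
      trans (outcome-slot t (βs i) λ { true () ; false () }) (cong (λ c → just (c , false)) (proj₂ (swapIf-sequences α β b i)))

  correct : Correct L 0 protocol
  correct α β b s init = subst (AllT (λ o → SwappedIff L 0 α β b (proj₂ o))) (sym run-≡)
    ((outcome-swapped false , tt) , (outcome-swapped true , tt) , tt)
    where open Run init

  prob-run : {α β : Vec Suit n} {b : Bool} {s : State M} → Initial L 0 α β b s → (τ : Trace M) →
             prob (λ o → does (proj₁ o ≟ᵗ τ)) (run protocol s) ≡
             prob (λ τ′ → does (τ′ ≟ᵗ τ)) (traceCoin (view s))
  prob-run {b = false} init τ = cong (prob _) (Run.run-≡ init)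
  prob-run {b = true} {s} init τ = trans (cong (prob _) run-≡)
    (prob-coin-comm {A = Trace M × State M} (λ o → does (proj₁ o ≟ᵗ τ))
                    (traceOf (view s) ♥ , outcome false) (traceOf (view s) ♣ , outcome true))
    where open Run init

  view-initial : {α β α′ β′ : Vec Suit n} {b b′ : Bool} {s s′ : State M} →
                 Initial L 0 α β b s → Initial L 0 α′ β′ b′ s′ → view s ≡ view s′
  view-initial {s = s} {s′} (slots , aux₁≡ , aux₂≡ , empty) (slots′ , aux₁≡′ , aux₂≡′ , empty′) = tabulate-cong sameLook
    where
    sameLook : ∀ p → visCard (s p) ≡ visCard (s′ p)
    sameLook p with slot? p | p ≟ᶠ aux₁ N 0 | p ≟ᶠ aux₂ N 0
    ... | yes (x , refl) | _ | _ = trans (cong visCard (slots x)) (sym (cong visCard (slots′ x)))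
    ... | no _ | yes refl | _ = trans (cong visCard aux₁≡) (sym (cong visCard aux₁≡′))
    ... | no _ | no _ | yes refl = trans (cong visCard aux₂≡) (sym (cong visCard aux₂≡′))
    ... | no unslotted | no p≢aux₁ | no p≢aux₂ =
      cong visCard (trans (empty p notSlot p≢aux₁ p≢aux₂) (sym (empty′ p notSlot p≢aux₁ p≢aux₂)))
      where
      notSlot : ∀ x → p ≢ slot x
      notSlot x p≡x = unslotted (x , sym p≡x)

  secure : Secure L 0 protocol
  secure α β b s α′ β′ b′ s′ init init′ τ = begin
    prob (λ o → does (proj₁ o ≟ᵗ τ)) (run protocol s)   ≡⟨ prob-run init τ ⟩
    prob (λ τ′ → does (τ′ ≟ᵗ τ)) (traceCoin (view s))   ≡⟨ cong (prob (λ τ′ → does (τ′ ≟ᵗ τ)) ∘ traceCoin) (view-initial init init′) ⟩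
    prob (λ τ′ → does (τ′ ≟ᵗ τ)) (traceCoin (view s′))  ≡⟨ prob-run init′ τ ⟨
    prob (λ o → does (proj₁ o ≟ᵗ τ)) (run protocol s′)  ∎
    where open ≡-Reasoning

theorem4 : (n N : ℕ) (L : Layout n N) →
    Σ ℕ (λ e → Σ (Protocol (Table N e)) (λ P → Correct L e P × Secure L e P))
theorem4 n N L = 0 , protocol , correct , secure
  where open BitControlledSwap L
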